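{- Let $Z=Z(V_R\cup V_B)$ be a $d$-dimensional symmetric $\Pi$-zonotope with $V_R\cup V_B\subseteq V(d)$ whose graph $G_Z$ (on $d+1$ vertices) is connected, with edges colored red (from $V_R$) or blue (from $V_B$). Then $G_Z$ has no cycle containing exactly one red edge, and no cycle containing exactly one blue edge.
   Context: Let $\mathbf e_1,\dots,\mathbf e_{d+1}$ be the standard basis of $\mathbb R^{d+1}$, $\mathbf e_{ij}=\mathbf e_i-\mathbf e_j$, $V(d)=\{\mathbf e_{ij}:i<j\}$, $Z(V)=\sum_{\mathbf v\in V}[\mathbf 0,\mathbf v]$. The graph of $Z(V)$ has vertices $1,\dots,d+1$ and an edge $\{i,j\}$ iff $\pm\mathbf e_{ij}\in V$. Two sets $V_1,V_2$ in a $d$-dimensional space, each of $d-1$ vectors spanning a $(d-1)$-dimensional subspace, are conjugate if for all $\mathbf u_1\in V_1,\mathbf u_2\in V_2$ both $\{\mathbf u_1\}\cup V_2$ and $\{\mathbf u_2\}\cup V_1$ span $d$-dimensional spaces; $Z(V_R\cup V_B)$ is symmetric if $V_R,V_B$ are conjugate in the span of $V_R\cup V_B$. -}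

module Defs where

open import Data.Nat using (ℕ; suc; _∸_; _≤_)
open import Data.Fin using (Fin) renaming (_<_ to _<ᶠ_)
open import Data.Fin.Properties using () renaming (_≟_ to _≟ᶠ_)
open import Data.Rational using (ℚ; 0ℚ; 1ℚ; _+_; _*_; _-_)
open import Data.List using (List; []; _∷_; length; map; zip; _++_; [_]; filter)
open import Data.List.Relation.Unary.All using (All)
open import Data.List.Relation.Unary.Unique.Propositional using (Unique)
open import Data.List.Membership.Propositional using (_∈_)
open import Data.List.Membership.DecPropositional using () renaming (_∈?_ to ∈?-gen)
open import Data.Product using (Σ; _×_; _,_; proj₁; proj₂)
open import Data.Product.Properties using (≡-dec)
open import Data.Sum using (_⊎_)
open import Relation.Binary.PropositionalEquality using (_≡_)
open import Relation.Nullary using (Dec; yes; no)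
open import Data.Sum using (inj₁; inj₂)
open import Relation.Nullary using (¬_)

Vect : ℕ → Set
Vect n = Fin n → ℚ

e : ∀ {n} → Fin n → Vect n
e i k with k ≟ᶠ i
... | yes _ = 1ℚ
... | no _  = 0ℚ

eDiff : ∀ {n} → Fin n → Fin n → Vect n
eDiff i j k = e i k - e j k

linComb : ∀ {n} → List ℚ → List (Vect n) → Vect n
linComb (c ∷ cs) (v ∷ vs) k = c * v k + linComb cs vs k
linComb _ _ k = 0ℚ

InSpan : ∀ {n} → List (Vect n) → Vect n → Set
InSpan vs w = Σ (List ℚ) λ cs → length cs ≡ length vs × (∀ k → linComb cs vs k ≡ w k)

LinIndep : ∀ {n} → List (Vect n) → Set
LinIndep vs = ∀ cs → length cs ≡ length vs → (∀ k → linComb cs vs k ≡ 0ℚ) → All (_≡ 0ℚ) cs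

SpanDim : ∀ {n} → List (Vect n) → ℕ → Set
SpanDim vs m = Σ (List (Vect _)) λ bs →
  length bs ≡ m × LinIndep bs × All (InSpan vs) bs × All (InSpan bs) vs

-- A subset of V(d) is a duplicate-free list of index pairs (i , j) with i < j,
-- the pair (i , j) standing for the vector e_ij in ℚ^(d+1).
Pair : ℕ → Set
Pair d = Fin (suc d) × Fin (suc d)

SubsetVd : ∀ {d} → List (Pair d) → Set
SubsetVd V = Unique V × All (λ p → proj₁ p <ᶠ proj₂ p) V

vec : ∀ {d} → Pair d → Vect (suc d)
vec p = eDiff (proj₁ p) (proj₂ p)

vecs : ∀ {d} → List (Pair d) → List (Vect (suc d))
vecs = map vec

-- V1, V2 conjugate in an m-dimensional space (m = dimension of the ambient span)
Conjugate : ∀ {d} → ℕ → List (Pair d) → List (Pair d) → Set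
Conjugate m V1 V2 =
  length V1 ≡ m ∸ 1 × SpanDim (vecs V1) (m ∸ 1) ×
  length V2 ≡ m ∸ 1 × SpanDim (vecs V2) (m ∸ 1) ×
  (∀ u1 → u1 ∈ V1 → SpanDim (vec u1 ∷ vecs V2) m) ×
  (∀ u2 → u2 ∈ V2 → SpanDim (vec u2 ∷ vecs V1) m)

-- Z(V_R ∪ V_B) symmetric: V_R, V_B conjugate in span (V_R ∪ V_B)
Symmetric : ∀ {d} → List (Pair d) → List (Pair d) → Set
Symmetric VR VB = Σ ℕ λ m → SpanDim (vecs (VR ++ VB)) m × Conjugate m VR VB

-- graph of Z(V): vertices Fin (d+1), edge {a,b} iff ±e_ab ∈ V
Adj : ∀ {d} → List (Pair d) → Fin (suc d) → Fin (suc d) → Set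
Adj V a b = (a , b) ∈ V ⊎ (b , a) ∈ V

adj? : ∀ {d} (V : List (Pair d)) (p : Pair d) → Dec (Adj V (proj₁ p) (proj₂ p))
adj? V (a , b) with ∈?-gen (≡-dec _≟ᶠ_ _≟ᶠ_) (a , b) V | ∈?-gen (≡-dec _≟ᶠ_ _≟ᶠ_) (b , a) V
... | yes p | _ = yes (inj₁ p)
... | no _ | yes q = yes (inj₂ q)
... | no p | no q = no λ { (inj₁ x) → p x ; (inj₂ y) → q y }

data Reach {d} (V : List (Pair d)) : Fin (suc d) → Fin (suc d) → Set where
  here : ∀ {a} → Reach V a a
  step : ∀ {a b c} → Adj V a b → Reach V b c → Reach V a c

Connected : ∀ {d} → List (Pair d) → Set
Connected V = ∀ a b → Reach V a b

cycleEdges : ∀ {A : Set} → List A → List (A × A)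
cycleEdges [] = []
cycleEdges (x ∷ xs) = zip (x ∷ xs) (xs ++ [ x ])

IsCycle : ∀ {d} → List (Pair d) → List (Fin (suc d)) → Set
IsCycle V vs = 3 ≤ length vs × Unique vs × All (λ p → Adj V (proj₁ p) (proj₂ p)) (cycleEdges vs)

colourCount : ∀ {d} → List (Pair d) → List (Fin (suc d)) → ℕ
colourCount W vs = length (filter (adj? W) (cycleEdges vs))

module Submission where

-- Theorem 12.  Suppose a cycle C of G_Z has exactly one red edge {a,b}.
-- The edge vectors e_xy of the consecutive vertices of C telescope to 0,
-- so e_ab is minus the sum of the blue edge vectors of C and lies in
-- span V_B; hence so does the vector u ∈ V_R with u = ±e_ab.  Symmetry
-- says that V_R and V_B are conjugate in a space of some dimension m:
-- |V_B| = m - 1 and {u} ∪ V_B spans an m-dimensional space.  That space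
-- lies in span V_B, which has m - 1 generators, and by the Steinitz lemma
-- (more than k vectors in the span of k vectors are dependent) its
-- dimension is at most m - 1 -- impossible unless m = 0, when V_R is empty.
-- Exchanging the colours gives the blue half.

open import Defs
open import Data.Nat using (ℕ; zero; suc; _∸_; _<_; _≤_; _≤?_; s≤s)
open import Data.Nat.Properties using (suc-injective; ≤-trans; ≤-reflexive; m<n⇒m<1+n; ≰⇒>; 1+n≰n)
open import Data.Fin using (Fin)
open import Data.List using (List; []; _∷_; _++_; length; map; replicate; zipWith; zip; filter; [_])
open import Data.List.Properties using (length-replicate; length-map)
open import Data.List.Relation.Unary.All using (All; []; _∷_; lookupAny)
import Data.List.Relation.Unary.All as All
open import Data.List.Relation.Unary.Any using (Any; here; there)
open import Data.List.Membership.Propositional using (_∈_)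
open import Data.List.Membership.Propositional.Properties using (∈-map⁺; ∈-++⁻)
open import Data.Product using (Σ; _×_; _,_)
open import Data.Sum using (_⊎_; inj₁; inj₂; swap)
open import Function using (_∘_)
open import Data.Empty using (⊥-elim)
open import Data.Rational using (ℚ; 0ℚ; 1ℚ; _+_; _*_; _-_; -_; 1/_; NonZero; ≢-nonZero)
open import Data.Rational.Properties
  using (_≟_; *-identityˡ; +-identityʳ; +-identityˡ; *-zeroˡ; *-zeroʳ; +-inverseʳ; 1≢0; *-inverseˡ; neg-injective)
open import Data.Rational.Solver using (module +-*-Solver)
open import Relation.Binary.PropositionalEquality using (_≡_; _≢_; refl; sym; trans; cong; cong₂; module ≡-Reasoning)
open import Relation.Nullary using (¬_; yes; no)

open +-*-Solver
open ≡-Reasoning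

Nontrivial : List ℚ → Set
Nontrivial = Any (_≢ 0ℚ)

Dependent : ∀ {n} → List (Vect n) → Set
Dependent vs = Σ (List ℚ) λ cs →
  length cs ≡ length vs × (∀ k → linComb cs vs k ≡ 0ℚ) × Nontrivial cs

independent⇒¬dependent : ∀ {n} {vs : List (Vect n)} → LinIndep vs → ¬ Dependent vs
independent⇒¬dependent ind (cs , len , vanish , nontrivial)
  with lookupAny (ind cs len vanish) nontrivial
... | c≡0 , c≢0 = c≢0 c≡0

zeros : ∀ {n} → List (Vect n) → List ℚ
zeros vs = replicate (length vs) 0ℚ

linComb-zeros : ∀ {n} (vs : List (Vect n)) k → linComb (zeros vs) vs k ≡ 0ℚ
linComb-zeros []       k = refl
linComb-zeros (v ∷ vs) k = trans (cong₂ _+_ (*-zeroˡ (v k)) (linComb-zeros vs k)) (+-identityʳ 0ℚ)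

linComb-head : ∀ {n} (v : Vect n) vs k → linComb (1ℚ ∷ zeros vs) (v ∷ vs) k ≡ v k
linComb-head v vs k = trans (cong₂ _+_ (*-identityˡ (v k)) (linComb-zeros vs k)) (+-identityʳ (v k))

linComb-+ : ∀ {n} (cs ds : List ℚ) (vs : List (Vect n)) → length cs ≡ length ds →
  ∀ k → linComb (zipWith _+_ cs ds) vs k ≡ linComb cs vs k + linComb ds vs k
linComb-+ []       []       vs       _   k = sym (+-identityʳ 0ℚ)
linComb-+ (c ∷ cs) (d ∷ ds) []       _   k = sym (+-identityʳ 0ℚ)
linComb-+ (c ∷ cs) (d ∷ ds) (v ∷ vs) len k = begin
  (c + d) * v k + linComb (zipWith _+_ cs ds) vs k
    ≡⟨ cong ((c + d) * v k +_) (linComb-+ cs ds vs (suc-injective len) k) ⟩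
  (c + d) * v k + (linComb cs vs k + linComb ds vs k)
    ≡⟨ solve 5 (λ c d v A B → (c :+ d) :* v :+ (A :+ B) := (c :* v :+ A) :+ (d :* v :+ B))
             refl c d (v k) (linComb cs vs k) (linComb ds vs k) ⟩
  (c * v k + linComb cs vs k) + (d * v k + linComb ds vs k) ∎

linComb-* : ∀ {n} (a : ℚ) (cs : List ℚ) (vs : List (Vect n)) →
  ∀ k → linComb (map (a *_) cs) vs k ≡ a * linComb cs vs k
linComb-* a []       vs       k = sym (*-zeroʳ a)
linComb-* a (c ∷ cs) []       k = sym (*-zeroʳ a)
linComb-* a (c ∷ cs) (v ∷ vs) k = begin
  a * c * v k + linComb (map (a *_) cs) vs k ≡⟨ cong (a * c * v k +_) (linComb-* a cs vs k) ⟩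
  a * c * v k + a * linComb cs vs k
    ≡⟨ solve 4 (λ a c v A → a :* c :* v :+ a :* A := a :* (c :* v :+ A)) refl a c (v k) (linComb cs vs k) ⟩
  a * (c * v k + linComb cs vs k) ∎

length-zipWith : ∀ (xs ys : List ℚ) → length xs ≡ length ys → length (zipWith _+_ xs ys) ≡ length xs
length-zipWith []       []       _   = refl
length-zipWith (x ∷ xs) (y ∷ ys) len = cong suc (length-zipWith xs ys (suc-injective len))

span-ext : ∀ {n} {vs : List (Vect n)} {u w : Vect n} → InSpan vs u → (∀ k → u k ≡ w k) → InSpan vs w
span-ext (cs , len , u≡) u≡w = cs , len , λ k → trans (u≡ k) (u≡w k)

span-zero : ∀ {n} (vs : List (Vect n)) → InSpan vs (λ _ → 0ℚ)
span-zero vs = zeros vs , length-replicate (length vs) , linComb-zeros vs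

span-add : ∀ {n} {vs : List (Vect n)} {u w : Vect n} →
  InSpan vs u → InSpan vs w → InSpan vs (λ k → u k + w k)
span-add {vs = vs} (cs , lc , u≡) (ds , ld , w≡) =
  zipWith _+_ cs ds , trans (length-zipWith cs ds (trans lc (sym ld))) lc ,
  λ k → trans (linComb-+ cs ds vs (trans lc (sym ld)) k) (cong₂ _+_ (u≡ k) (w≡ k))

span-scale : ∀ {n} {vs : List (Vect n)} {u : Vect n} (a : ℚ) → InSpan vs u → InSpan vs (λ k → a * u k)
span-scale {vs = vs} a (cs , len , u≡) =
  map (a *_) cs , trans (length-map (a *_) cs) len , λ k → trans (linComb-* a cs vs k) (cong (a *_) (u≡ k))

span-∈ : ∀ {n} {vs : List (Vect n)} {v : Vect n} → v ∈ vs → InSpan vs v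
span-∈ {vs = v ∷ vs} (here refl) =
  1ℚ ∷ zeros vs , cong suc (length-replicate (length vs)) , linComb-head v vs
span-∈ {vs = u ∷ vs} (there v∈vs) with span-∈ v∈vs
... | cs , len , v≡ = 0ℚ ∷ cs , cong suc len , λ k → trans (cong₂ _+_ (*-zeroˡ (u k)) (v≡ k)) (+-identityˡ _)

span-trans : ∀ {n} {ws vs : List (Vect n)} {x : Vect n} → All (InSpan ws) vs → InSpan vs x → InSpan ws x
span-trans {ws = ws} []             ([] , _ , x≡) = span-ext (span-zero ws) x≡
span-trans {ws = ws} (v∈ ∷ vs∈) (c ∷ cs , len , x≡) =
  span-ext (span-add (span-scale c v∈) (span-trans vs∈ (cs , suc-injective len , λ k → refl))) x≡

span-[] : ∀ {n} {v : Vect n} → InSpan [] v → ∀ k → v k ≡ 0ℚ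
span-[] ([] , _ , v≡) k = sym (v≡ k)

span-∷ : ∀ {n} {w : Vect n} {ws : List (Vect n)} {u : Vect n} → InSpan (w ∷ ws) u →
  Σ ℚ λ d → Σ (Vect n) λ r → InSpan ws r × (∀ k → u k ≡ d * w k + r k)
span-∷ {ws = ws} (d ∷ ds , len , u≡) = d , linComb ds ws , (ds , suc-injective len , λ k → refl) , λ k → sym (u≡ k)

-- shift vs ts p = [ vᵢ - tᵢ p ]ᵢ, the vectors vs after eliminating multiples of p.
shift : ∀ {n} → List (Vect n) → List ℚ → Vect n → List (Vect n)
shift (v ∷ vs) (t ∷ ts) p = (λ k → v k - t * p k) ∷ shift vs ts p
shift _        _        p = []

length-shift : ∀ {n} (vs : List (Vect n)) ts p → length ts ≡ length vs → length (shift vs ts p) ≡ length vs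
length-shift []       []       p _   = refl
length-shift (v ∷ vs) (t ∷ ts) p len = cong suc (length-shift vs ts p (suc-injective len))

dot : List ℚ → List ℚ → ℚ
dot (a ∷ as) (t ∷ ts) = a * t + dot as ts
dot _        _        = 0ℚ

0≡0-0*x : ∀ x → 0ℚ ≡ 0ℚ - 0ℚ * x
0≡0-0*x = solve 1 (λ x → con 0ℚ := con 0ℚ :- con 0ℚ :* x) refl

linComb-shift : ∀ {n} (as : List ℚ) (vs : List (Vect n)) ts p → length ts ≡ length vs →
  ∀ k → linComb as (shift vs ts p) k ≡ linComb as vs k - dot as ts * p k
linComb-shift []       vs       ts       p _   k = 0≡0-0*x (p k)
linComb-shift (a ∷ as) []       []       p _   k = 0≡0-0*x (p k)
linComb-shift (a ∷ as) (v ∷ vs) (t ∷ ts) p len k = begin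
  a * (v k - t * p k) + linComb as (shift vs ts p) k
    ≡⟨ cong (a * (v k - t * p k) +_) (linComb-shift as vs ts p (suc-injective len) k) ⟩
  a * (v k - t * p k) + (linComb as vs k - dot as ts * p k)
    ≡⟨ solve 6 (λ a v t p A D → a :* (v :- t :* p) :+ (A :- D :* p) := (a :* v :+ A) :- (a :* t :+ D) :* p)
             refl a (v k) t (p k) (linComb as vs k) (dot as ts) ⟩
  (a * v k + linComb as vs k) - (a * t + dot as ts) * p k ∎

-- A dependence among the shifted vectors vᵢ - tᵢ p, where p = v + Σ bᵢ vᵢ,
-- yields a dependence among v ∷ vs: Σ aᵢ vᵢ - s v - s Σ bᵢ vᵢ = 0, s = a · t.
-- If s = 0 the relation Σ aᵢ vᵢ = 0 is already nontrivial; otherwise v has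
-- the nonzero coefficient -s.
lift-dependence : ∀ {n} (v : Vect n) (vs : List (Vect n)) (b ts : List ℚ) →
  length b ≡ length vs → length ts ≡ length vs →
  Dependent (shift vs ts (λ k → v k + linComb b vs k)) → Dependent (v ∷ vs)
lift-dependence {n} v vs b ts lb lts (as , las , vanish , nontrivial) with dot as ts ≟ 0ℚ
... | yes s≡0 = 0ℚ ∷ as , cong suc las′ , relation , there nontrivial
  where
  p : Vect n
  p k = v k + linComb b vs k
  las′ : length as ≡ length vs
  las′ = trans las (length-shift vs ts p lts)
  relation : ∀ k → 0ℚ * v k + linComb as vs k ≡ 0ℚ
  relation k = begin
    0ℚ * v k + linComb as vs k          ≡⟨ solve 3 (λ v A P → con 0ℚ :* v :+ A := A :- con 0ℚ :* P) refl (v k) (linComb as vs k) (p k) ⟩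
    linComb as vs k - 0ℚ * p k          ≡⟨ cong (λ s → linComb as vs k - s * p k) (sym s≡0) ⟩
    linComb as vs k - dot as ts * p k   ≡⟨ sym (linComb-shift as vs ts p lts k) ⟩
    linComb as (shift vs ts p) k        ≡⟨ vanish k ⟩
    0ℚ ∎
... | no s≢0 = (- s) ∷ zipWith _+_ as (map ((- s) *_) b) , cong suc lcs , relation , here (λ -s≡0 → s≢0 (neg-injective -s≡0))
  where
  s : ℚ
  s = dot as ts
  p : Vect n
  p k = v k + linComb b vs k
  las′ : length as ≡ length vs
  las′ = trans las (length-shift vs ts p lts)
  las≡lb : length as ≡ length (map ((- s) *_) b)
  las≡lb = trans las′ (sym (trans (length-map _ b) lb))
  lcs : length (zipWith _+_ as (map ((- s) *_) b)) ≡ length vs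
  lcs = trans (length-zipWith as (map ((- s) *_) b) las≡lb) las′
  relation : ∀ k → (- s) * v k + linComb (zipWith _+_ as (map ((- s) *_) b)) vs k ≡ 0ℚ
  relation k = begin
    (- s) * v k + linComb (zipWith _+_ as (map ((- s) *_) b)) vs k
      ≡⟨ cong ((- s) * v k +_) (linComb-+ as _ vs las≡lb k) ⟩
    (- s) * v k + (linComb as vs k + linComb (map ((- s) *_) b) vs k)
      ≡⟨ cong (λ x → (- s) * v k + (linComb as vs k + x)) (linComb-* (- s) b vs k) ⟩
    (- s) * v k + (linComb as vs k + (- s) * linComb b vs k)
      ≡⟨ solve 4 (λ s v A B → (:- s) :* v :+ (A :+ (:- s) :* B) := A :- s :* (v :+ B))
               refl s (v k) (linComb as vs k) (linComb b vs k) ⟩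
    linComb as vs k - s * p k          ≡⟨ sym (linComb-shift as vs ts p lts k) ⟩
    linComb as (shift vs ts p) k       ≡⟨ vanish k ⟩
    0ℚ ∎

-- The field computation behind one elimination step (c⁻¹ abstracted):
-- (d w + rᵤ) - (d c⁻¹)(c w + r) = rᵤ - (d c⁻¹) r  when  c⁻¹ c = 1.
cancel-pivot : ∀ d w rᵤ c r {c⁻¹} → c⁻¹ * c ≡ 1ℚ →
  (d * w + rᵤ) - d * c⁻¹ * (c * w + r) ≡ rᵤ + (- (d * c⁻¹)) * r
cancel-pivot d w rᵤ c r {c⁻¹} c⁻¹c≡1 = begin
  (d * w + rᵤ) - d * c⁻¹ * (c * w + r)
    ≡⟨ solve 6 (λ d w rᵤ c⁻¹ c r → (d :* w :+ rᵤ) :- d :* c⁻¹ :* (c :* w :+ r)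
                                  := (rᵤ :+ (:- (d :* c⁻¹)) :* r) :+ d :* w :* (con 1ℚ :- c⁻¹ :* c))
             refl d w rᵤ c⁻¹ c r ⟩
  (rᵤ + (- (d * c⁻¹)) * r) + d * w * (1ℚ - c⁻¹ * c)
    ≡⟨ cong (λ x → (rᵤ + (- (d * c⁻¹)) * r) + d * w * (1ℚ - x)) c⁻¹c≡1 ⟩
  (rᵤ + (- (d * c⁻¹)) * r) + d * w * (1ℚ - 1ℚ)
    ≡⟨ solve 2 (λ X y → X :+ y :* (con 1ℚ :- con 1ℚ) := X) refl (rᵤ + (- (d * c⁻¹)) * r) (d * w) ⟩
  rᵤ + (- (d * c⁻¹)) * r ∎

module Elimination {n : ℕ} (w : Vect n) (ws : List (Vect n)) where

  Pivot : Vect n → List (Vect n) → Set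
  Pivot v vs = Σ (List ℚ) λ b → length b ≡ length vs ×
    Σ ℚ λ c → c ≢ 0ℚ × Σ (Vect n) λ r → InSpan ws r × (∀ k → v k + linComb b vs k ≡ c * w k + r k)

  find-pivot : ∀ v vs → All (InSpan (w ∷ ws)) (v ∷ vs) → All (InSpan ws) (v ∷ vs) ⊎ Pivot v vs
  find-pivot v vs (v∈ ∷ vs∈) with span-∷ v∈
  ... | d , r , r∈ , v≡ with d ≟ 0ℚ
  ...   | no d≢0 = inj₂ (zeros vs , length-replicate (length vs) , d , d≢0 , r , r∈ , λ k → begin
            v k + linComb (zeros vs) vs k ≡⟨ cong (v k +_) (linComb-zeros vs k) ⟩
            v k + 0ℚ                      ≡⟨ +-identityʳ (v k) ⟩
            v k                           ≡⟨ v≡ k ⟩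
            d * w k + r k                 ∎)
  ...   | yes refl = extend vs vs∈
    where
    v∈ws : InSpan ws v
    v∈ws = span-ext r∈ λ k → sym (trans (v≡ k) (trans (cong (_+ r k) (*-zeroˡ (w k))) (+-identityˡ (r k))))
    -- v does not involve w, so a pivot of the tail, shifted by v, is one of v ∷ vs.
    extend : ∀ vs → All (InSpan (w ∷ ws)) vs → All (InSpan ws) (v ∷ vs) ⊎ Pivot v vs
    extend []       []         = inj₁ (v∈ws ∷ [])
    extend (u ∷ us) (u∈ ∷ us∈) with find-pivot u us (u∈ ∷ us∈)
    ... | inj₁ all = inj₁ (v∈ws ∷ all)
    ... | inj₂ (b , lb , c , c≢0 , r′ , r′∈ , u≡) =
      inj₂ (1ℚ ∷ b , cong suc lb , c , c≢0 , (λ k → r′ k + v k) , span-add r′∈ v∈ws , λ k → begin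
        v k + (1ℚ * u k + linComb b us k)
          ≡⟨ solve 3 (λ v u B → v :+ (con 1ℚ :* u :+ B) := (u :+ B) :+ v) refl (v k) (u k) (linComb b us k) ⟩
        (u k + linComb b us k) + v k  ≡⟨ cong (_+ v k) (u≡ k) ⟩
        (c * w k + r′ k) + v k
          ≡⟨ solve 4 (λ c w r v → (c :* w :+ r) :+ v := c :* w :+ (r :+ v)) refl c (w k) (r′ k) (v k) ⟩
        c * w k + (r′ k + v k) ∎)

  -- Given p = c w + r with c ≠ 0, every u = d w + r_u ∈ span (w ∷ ws) has
  -- u - (d/c) p = r_u - (d/c) r ∈ span ws.
  eliminate : ∀ {c} → c ≢ 0ℚ → (p r : Vect n) → InSpan ws r → (∀ k → p k ≡ c * w k + r k) →
    ∀ {u} → InSpan (w ∷ ws) u → Σ ℚ λ t → InSpan ws (λ k → u k - t * p k)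
  eliminate {c} c≢0 p r r∈ p≡ {u} u∈ with span-∷ u∈
  ... | d , rᵤ , rᵤ∈ , u≡ = d * c⁻¹ , span-ext (span-add rᵤ∈ (span-scale (- (d * c⁻¹)) r∈)) λ k → sym (begin
      u k - d * c⁻¹ * p k                           ≡⟨ cong₂ (λ x y → x - d * c⁻¹ * y) (u≡ k) (p≡ k) ⟩
      (d * w k + rᵤ k) - d * c⁻¹ * (c * w k + r k)  ≡⟨ cancel-pivot d (w k) (rᵤ k) c (r k) (*-inverseˡ c) ⟩
      rᵤ k + (- (d * c⁻¹)) * r k                    ∎)
    where
    instance
      c-nonZero : NonZero c
      c-nonZero = ≢-nonZero c≢0
    c⁻¹ : ℚ
    c⁻¹ = 1/ c

  eliminate-all : ∀ {c} → c ≢ 0ℚ → (p r : Vect n) → InSpan ws r → (∀ k → p k ≡ c * w k + r k) →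
    ∀ {us} → All (InSpan (w ∷ ws)) us → Σ (List ℚ) λ ts → length ts ≡ length us × All (InSpan ws) (shift us ts p)
  eliminate-all c≢0 p r r∈ p≡ []         = [] , refl , []
  eliminate-all c≢0 p r r∈ p≡ (u∈ ∷ us∈) =
    let (t , shifted∈) = eliminate c≢0 p r r∈ p≡ u∈
        (ts , len , all) = eliminate-all c≢0 p r r∈ p≡ us∈
    in t ∷ ts , cong suc len , shifted∈ ∷ all

  -- With a pivot, eliminating w from the tail leaves |vs| vectors in span ws;
  -- a dependence among them (supplied by the induction hypothesis) lifts to v ∷ vs.
  pivot-dependence : ∀ {v vs} → length ws < length vs →
    (∀ us → length ws < length us → All (InSpan ws) us → Dependent us) →
    All (InSpan (w ∷ ws)) vs → Pivot v vs → Dependent (v ∷ vs)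
  pivot-dependence {v} {vs} |ws|<|vs| steinitz-ws vs∈ (b , lb , c , c≢0 , r , r∈ , p≡) =
    let (ts , lts , shifted∈) = eliminate-all c≢0 p r r∈ p≡ vs∈
        |ws|<|shifted| = ≤-trans |ws|<|vs| (≤-reflexive (sym (length-shift vs ts p lts)))
    in lift-dependence v vs b ts lb lts (steinitz-ws (shift vs ts p) |ws|<|shifted| shifted∈)
    where
    p : Vect n
    p k = v k + linComb b vs k

steinitz : ∀ {n} (ws vs : List (Vect n)) → length ws < length vs → All (InSpan ws) vs → Dependent vs
steinitz []       (v ∷ vs) _ (v∈ ∷ _) =
  1ℚ ∷ zeros vs , cong suc (length-replicate (length vs)) ,
  (λ k → trans (linComb-head v vs k) (span-[] v∈ k)) , here 1≢0
steinitz (w ∷ ws) (v ∷ vs) (s≤s |ws|<|vs|) vs∈ with Elimination.find-pivot w ws v vs vs∈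
... | inj₁ vs∈ws = steinitz ws (v ∷ vs) (m<n⇒m<1+n |ws|<|vs|) vs∈ws
... | inj₂ pivot = Elimination.pivot-dependence w ws |ws|<|vs| (steinitz ws) (All.tail vs∈) pivot

dimension≤generators : ∀ {n} {vs ws : List (Vect n)} {m} → SpanDim vs m → All (InSpan ws) vs → m ≤ length ws
dimension≤generators {ws = ws} (bs , refl , bs-indep , bs∈vs , _) vs∈ws with length bs ≤? length ws
... | yes m≤|ws| = m≤|ws|
... | no  m≰|ws| = ⊥-elim (independent⇒¬dependent bs-indep
                     (steinitz ws bs (≰⇒> m≰|ws|) (All.map (span-trans vs∈ws) bs∈vs)))

Edge : ∀ {d} → List (Pair d) → Pair d → Set
Edge W (a , b) = Adj W a b

edgeSum : ∀ {d} → List (Pair d) → Vect (suc d)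
edgeSum []      k = 0ℚ
edgeSum (p ∷ E) k = vec p k + edgeSum E k

path-telescopes : ∀ {d} (x : Fin (suc d)) xs z k → edgeSum (zip (x ∷ xs) (xs ++ [ z ])) k ≡ e x k - e z k
path-telescopes x []       z k = +-identityʳ _
path-telescopes x (y ∷ ys) z k = begin
  (e x k - e y k) + edgeSum (zip (y ∷ ys) (ys ++ [ z ])) k ≡⟨ cong ((e x k - e y k) +_) (path-telescopes y ys z k) ⟩
  (e x k - e y k) + (e y k - e z k)
    ≡⟨ solve 3 (λ a b c → (a :- b) :+ (b :- c) := a :- c) refl (e x k) (e y k) (e z k) ⟩
  e x k - e z k ∎

cycle-sum-zero : ∀ {d} (vs : List (Fin (suc d))) k → edgeSum (cycleEdges vs) k ≡ 0ℚ
cycle-sum-zero []       k = refl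
cycle-sum-zero (x ∷ xs) k = trans (path-telescopes x xs x k) (+-inverseʳ (e x k))

vec-flip : ∀ {d} (a b : Fin (suc d)) k → (- 1ℚ) * vec (a , b) k ≡ vec (b , a) k
vec-flip a b k = solve 2 (λ x y → (:- con 1ℚ) :* (x :- y) := y :- x) refl (e a k) (e b k)

edge⇒inSpan : ∀ {d} (W : List (Pair d)) {p} → Edge W p → InSpan (vecs W) (vec p)
edge⇒inSpan W {a , b} (inj₁ ab∈W) = span-∈ (∈-map⁺ vec ab∈W)
edge⇒inSpan W {a , b} (inj₂ ba∈W) = span-ext (span-scale (- 1ℚ) (span-∈ (∈-map⁺ vec ba∈W))) (vec-flip b a)

edge-++ : ∀ {d} (W₁ W₂ : List (Pair d)) {p} → Edge (W₁ ++ W₂) p → Edge W₁ p ⊎ Edge W₂ p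
edge-++ W₁ W₂ (inj₁ ab∈) with ∈-++⁻ W₁ ab∈
... | inj₁ ab∈W₁ = inj₁ (inj₁ ab∈W₁)
... | inj₂ ab∈W₂ = inj₂ (inj₁ ab∈W₂)
edge-++ W₁ W₂ (inj₂ ba∈) with ∈-++⁻ W₁ ba∈
... | inj₁ ba∈W₁ = inj₁ (inj₂ ba∈W₁)
... | inj₂ ba∈W₂ = inj₂ (inj₂ ba∈W₂)

no-W₁-edge : ∀ {d} (W₁ W₂ : List (Pair d)) E → All (λ p → Edge W₁ p ⊎ Edge W₂ p) E →
  length (filter (adj? W₁) E) ≡ 0 → InSpan (vecs W₂) (edgeSum E)
no-W₁-edge W₁ W₂ []      []                 none = span-zero (vecs W₂)
no-W₁-edge W₁ W₂ (p ∷ E) (coloured ∷ rest) none with adj? W₁ p | coloured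
... | no _  | inj₂ p∈W₂ = span-add (edge⇒inSpan W₂ p∈W₂) (no-W₁-edge W₁ W₂ E rest none)
... | no ¬p | inj₁ p∈W₁ = ⊥-elim (¬p p∈W₁)

one-W₁-edge : ∀ {d} (W₁ W₂ : List (Pair d)) E → All (λ p → Edge W₁ p ⊎ Edge W₂ p) E →
  length (filter (adj? W₁) E) ≡ 1 →
  Σ (Pair d) λ q → Edge W₁ q × InSpan (vecs W₂) (λ k → edgeSum E k - vec q k)
one-W₁-edge W₁ W₂ (p ∷ E) (coloured ∷ rest) one with adj? W₁ p | coloured
... | yes p∈W₁ | _ = p , p∈W₁ , span-ext (no-W₁-edge W₁ W₂ E rest (suc-injective one))
        (λ k → solve 2 (λ x y → y := (x :+ y) :- x) refl (vec p k) (edgeSum E k))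
... | no ¬p | inj₁ p∈W₁ = ⊥-elim (¬p p∈W₁)
... | no _  | inj₂ p∈W₂ with one-W₁-edge W₁ W₂ E rest one
...   | q , q∈W₁ , rest∈ = q , q∈W₁ , span-ext (span-add (edge⇒inSpan W₂ p∈W₂) rest∈)
        (λ k → solve 3 (λ x y z → x :+ (y :- z) := (x :+ y) :- z) refl (vec p k) (edgeSum E k) (vec q k))

-- A cycle with exactly one W₁ edge: that edge's vector u ∈ W₁ lies in span W₂,
-- being minus the sum of the other (W₂) edge vectors.
lone-edge-in-span : ∀ {d} (W₁ W₂ : List (Pair d)) vs →
  All (λ p → Edge W₁ p ⊎ Edge W₂ p) (cycleEdges vs) → colourCount W₁ vs ≡ 1 →
  Σ (Pair d) λ u → u ∈ W₁ × InSpan (vecs W₂) (vec u)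
lone-edge-in-span W₁ W₂ vs coloured one with one-W₁-edge W₁ W₂ (cycleEdges vs) coloured one
... | (a , b) , ab-edge , rest∈ = oriented ab-edge
  where
  ab∈span : InSpan (vecs W₂) (vec (a , b))
  ab∈span = span-ext (span-scale (- 1ℚ) rest∈) λ k → begin
    (- 1ℚ) * (edgeSum (cycleEdges vs) k - vec (a , b) k) ≡⟨ cong (λ x → (- 1ℚ) * (x - vec (a , b) k)) (cycle-sum-zero vs k) ⟩
    (- 1ℚ) * (0ℚ - vec (a , b) k)                         ≡⟨ solve 1 (λ y → (:- con 1ℚ) :* (con 0ℚ :- y) := y) refl (vec (a , b) k) ⟩
    vec (a , b) k ∎
  oriented : Adj W₁ a b → Σ (Pair _) λ u → u ∈ W₁ × InSpan (vecs W₂) (vec u)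
  oriented (inj₁ ab∈W₁) = (a , b) , ab∈W₁ , ab∈span
  oriented (inj₂ ba∈W₁) = (b , a) , ba∈W₁ , span-ext (span-scale (- 1ℚ) ab∈span) (vec-flip a b)

-- If V₁, V₂ are conjugate in an m-space, no u ∈ V₁ lies in span V₂: otherwise
-- the m-dimensional span of u ∷ V₂ would be generated by the m - 1 vectors V₂.
conjugate⇒∉span : ∀ {d} {V₁ V₂ : List (Pair d)} m → length V₁ ≡ m ∸ 1 → length V₂ ≡ m ∸ 1 →
  (∀ u → u ∈ V₁ → SpanDim (vec u ∷ vecs V₂) m) → ∀ {u} → u ∈ V₁ → ¬ InSpan (vecs V₂) (vec u)
conjugate⇒∉span {V₁ = []}    zero    _      _      _    ()
conjugate⇒∉span {V₁ = _ ∷ _} zero    ()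
conjugate⇒∉span {V₂ = V₂}    (suc m) _      |V₂|   conj {u} u∈V₁ u∈span =
  1+n≰n (≤-trans (dimension≤generators (conj u u∈V₁) (u∈span ∷ All.tabulate span-∈))
                 (≤-reflexive (trans (length-map vec V₂) |V₂|)))

no-lone-edge : ∀ {d} (W₁ W₂ : List (Pair d)) m → length W₁ ≡ m ∸ 1 → length W₂ ≡ m ∸ 1 →
  (∀ u → u ∈ W₁ → SpanDim (vec u ∷ vecs W₂) m) → ∀ vs →
  All (λ p → Edge W₁ p ⊎ Edge W₂ p) (cycleEdges vs) → colourCount W₁ vs ≢ 1
no-lone-edge W₁ W₂ m |W₁| |W₂| conj vs coloured one =
  let (u , u∈W₁ , u∈span) = lone-edge-in-span W₁ W₂ vs coloured one
  in conjugate⇒∉span m |W₁| |W₂| conj u∈W₁ u∈span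

mainTheorem12 : (d : ℕ) (VR VB : List (Pair d)) →
    SubsetVd VR → SubsetVd VB →
    SpanDim (vecs (VR ++ VB)) d →
    Symmetric VR VB →
    Connected (VR ++ VB) →
    (¬ Σ (List (Fin (suc d))) (λ vs → IsCycle (VR ++ VB) vs × colourCount VR vs ≡ 1)) ×
    (¬ Σ (List (Fin (suc d))) (λ vs → IsCycle (VR ++ VB) vs × colourCount VB vs ≡ 1))
mainTheorem12 d VR VB _ _ _ (m , _ , |VR| , _ , |VB| , _ , VR-conj , VB-conj) _ =
  (λ (vs , (_ , _ , edges) , one) → no-lone-edge VR VB m |VR| |VB| VR-conj vs (All.map (edge-++ VR VB) edges) one) ,
  (λ (vs , (_ , _ , edges) , one) → no-lone-edge VB VR m |VB| |VR| VB-conj vs (All.map (swap ∘ edge-++ VR VB) edges) one)
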